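{- Let $\mathcal{H}\subseteq 2^{[n]}\setminus\{\emptyset\}$ be a minimally transversal-free hypergraph. Then for every $k\in\mathbb{Z}_+$, \[ N(k)=\{x\in\mathbb{Z}_+^n : m(x)=k \text{ and } M(x)\notin\mathcal{H}^t\}. \]
   Context: Hypergraph NIM $\mathrm{NIM}_{\mathcal{H}}$: positions are $x\in\mathbb{Z}_+^n$; $x\to x'$ is a move iff $x\ge x'$ componentwise and $\{i: x'_i<x_i\}\in\mathcal{H}$. For a hypergraph $\mathcal{F}$, $\mathcal{F}^t=\{T\subseteq[n]: T\cap F\neq\emptyset\ \forall F\in\mathcal{F}\}$. For $S\subseteq[n]$, $\mathcal{H}_S=\{H\in\mathcal{H}: H\subseteq S\}$. $\mathcal{H}$ is minimally transversal-free (MTF) if $\mathcal{H}\cap\mathcal{H}^t=\emptyset$ and for every nonempty proper subset $S\subsetneq[n]$ there is $H\in\mathcal{H}_S$ with $H\in(\mathcal{H}_S)^t$. For a position $x$: $m(x)=\min_i x_i$, $M(x)=\{i: x_i=m(x)\}$. For $k\in\mathbb{Z}_+$: $P(k)=\{x: m(x)=k,\ M(x)\in\mathcal{H}^t\}$ and $N(k)=\{x: \text{there is a move } x\to x' \text{ with } x'\in P(k)\}$. -}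

module Defs where

open import Data.Nat using (ℕ; zero; suc; _≤_; _⊓_; _≡ᵇ_; _<ᵇ_)
open import Data.Fin using (Fin; zero; suc)
open import Data.Fin.Subset using (Subset; _∈_; _⊆_; Nonempty; ⊤; inside; outside)
open import Data.Fin.Subset.Properties using (_⊆?_)
open import Data.Vec using (tabulate)
open import Data.List using (List; filter)
open import Data.List.Membership.Propositional renaming (_∈_ to _∈ₗ_)
open import Data.Product using (Σ; ∃; ∃-syntax; _×_)
open import Data.Bool using (if_then_else_)
open import Function using (_∘_)
open import Relation.Binary.PropositionalEquality using (_≡_; _≢_)
open import Relation.Nullary using (¬_)

Hypergraph : ℕ → Set
Hypergraph n = List (Subset n)

NoEmptyEdge : ∀ {n} → Hypergraph n → Set
NoEmptyEdge ℋ = ∀ H → H ∈ₗ ℋ → Nonempty H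

Meets : ∀ {n} → Subset n → Subset n → Set
Meets T F = ∃[ i ] (i ∈ T × i ∈ F)

IsTransversal : ∀ {n} → Hypergraph n → Subset n → Set
IsTransversal ℋ T = ∀ F → F ∈ₗ ℋ → Meets T F

restrict : ∀ {n} → Hypergraph n → Subset n → Hypergraph n
restrict ℋ S = filter (_⊆? S) ℋ

MTF : ∀ {n} → Hypergraph n → Set
MTF {n} ℋ =
  (∀ H → H ∈ₗ ℋ → ¬ IsTransversal ℋ H)
  × (∀ (S : Subset n) → Nonempty S → S ≢ ⊤ →
       ∃[ H ] (H ∈ₗ restrict ℋ S × IsTransversal (restrict ℋ S) H))

Position : ℕ → Set
Position n = Fin n → ℕ

m : ∀ {n} → Position (suc n) → ℕ
m {zero}  x = x zero
m {suc n} x = x zero ⊓ m (x ∘ suc)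

M : ∀ {n} → Position (suc n) → Subset (suc n)
M x = tabulate (λ i → if x i ≡ᵇ m x then inside else outside)

decreased : ∀ {n} → Position n → Position n → Subset n
decreased x x' = tabulate (λ i → if x' i <ᵇ x i then inside else outside)

Move : ∀ {n} → Hypergraph n → Position n → Position n → Set
Move ℋ x x' = (∀ i → x' i ≤ x i) × decreased x x' ∈ₗ ℋ

InP : ∀ {n} → Hypergraph (suc n) → ℕ → Position (suc n) → Set
InP ℋ k x = m x ≡ k × IsTransversal ℋ (M x)

InN : ∀ {n} → Hypergraph (suc n) → ℕ → Position (suc n) → Set
InN ℋ k x = ∃[ x' ] (Move ℋ x x' × InP ℋ k x')

{-# OPTIONS --safe #-}
-- Let x → x' be a move with x' ∈ P(k) and decreased edge H. If m(x) > k, every coordinate of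
-- M(x') drops, so H ⊇ M(x') is a transversal, contradicting ℋ ∩ ℋ^t = ∅; hence m(x) = k, and
-- H misses M(x) (those coordinates cannot drop below k), so M(x) is not a transversal.
-- Conversely, if m(x) = k and M(x) is not a transversal, then S = ∁ M(x) is a nonempty proper
-- subset, and MTF provides H ∈ ℋ_S that is a transversal of ℋ_S. Lowering x to k on H is a move
-- whose target has minimum k and M ⊇ H ∪ M(x); this set meets every edge: those inside S
-- through H, the others through M(x).
module Submission where

open import Defs
open import Data.Nat using (ℕ; suc; _≤_; _<_; _≡ᵇ_; _<ᵇ_)
open import Data.Nat.Properties
open import Data.Bool using (Bool; true; false; if_then_else_; T)
open import Data.Fin using (Fin; zero; suc)
open import Data.Fin.Subset using (Subset; _∈_; _∉_; _⊆_; _∪_; Nonempty; ⊤; ∁; inside; outside)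
open import Data.Fin.Subset.Properties
  using (_⊆?_; _∈?_; ∈⊤; ⊆-antisym; nonempty?; x∈∁p⇒x∉p; x∉∁p⇒x∈p; x∉p⇒x∈∁p; x∈p∪q⁺; x∈p∪q⁻)
open import Data.Fin.Properties using (any?)
open import Data.Vec using (tabulate)
open import Data.Vec.Properties using ([]=⇒lookup; lookup⇒[]=; lookup∘tabulate)
open import Data.List.Membership.Propositional using () renaming (_∈_ to _∈ₗ_)
open import Data.List.Membership.Propositional.Properties using (∈-filter⁺; ∈-filter⁻)
open import Data.Product using (_×_; _,_; proj₁; proj₂; ∃-syntax)
open import Data.Sum using (_⊎_; inj₁; inj₂)
open import Function using (_∘_)
open import Function.Bundles using (_⇔_; mk⇔)
open import Relation.Binary.PropositionalEquality
open import Relation.Nullary using (¬_; yes; no; contradiction)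
open import Relation.Nullary.Decidable using (_×-dec_)

private
  variable
    n : ℕ

select : (Fin n → Bool) → Subset n
select b = tabulate (λ j → if b j then inside else outside)

∈-select⁻ : ∀ (b : Fin n → Bool) {i} → i ∈ select b → T (b i)
∈-select⁻ b {i} i∈ = inside⇒T (trans (sym (lookup∘tabulate _ i)) ([]=⇒lookup i∈))
  where
  inside⇒T : ∀ {c} → (if c then inside else outside) ≡ inside → T c
  inside⇒T {true}  _  = _
  inside⇒T {false} ()

∈-select⁺ : ∀ (b : Fin n → Bool) {i} → T (b i) → i ∈ select b
∈-select⁺ b {i} bi = lookup⇒[]= i _ (trans (lookup∘tabulate _ i) (T⇒inside bi))
  where
  T⇒inside : ∀ {c} → T c → (if c then inside else outside) ≡ inside
  T⇒inside {true} _ = refl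

∈-decreased⁻ : ∀ (x x' : Position n) {i} → i ∈ decreased x x' → x' i < x i
∈-decreased⁻ x x' {i} = <ᵇ⇒< (x' i) (x i) ∘ ∈-select⁻ (λ j → x' j <ᵇ x j)

∈-decreased⁺ : ∀ (x x' : Position n) {i} → x' i < x i → i ∈ decreased x x'
∈-decreased⁺ x x' = ∈-select⁺ (λ j → x' j <ᵇ x j) ∘ <⇒<ᵇ

m-lowerBound : ∀ (x : Position (suc n)) i → m x ≤ x i
m-lowerBound {ℕ.zero} x zero    = ≤-refl
m-lowerBound {suc n}  x zero    = m⊓n≤m _ _
m-lowerBound {suc n}  x (suc i) = ≤-trans (m⊓n≤n _ _) (m-lowerBound (x ∘ suc) i)

m-greatest : ∀ (x : Position (suc n)) {k} → (∀ i → k ≤ x i) → k ≤ m x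
m-greatest {ℕ.zero} x k≤ = k≤ zero
m-greatest {suc n}  x k≤ = ⊓-glb (k≤ zero) (m-greatest (x ∘ suc) (k≤ ∘ suc))

m-attained : ∀ (x : Position (suc n)) → ∃[ i ] (x i ≡ m x)
m-attained {ℕ.zero} x = zero , refl
m-attained {suc n}  x with ⊓-sel (x zero) (m (x ∘ suc))
... | inj₁ e = zero , sym e
... | inj₂ e = let (i , xi≡) = m-attained (x ∘ suc) in suc i , trans xi≡ (sym e)

m-unique : ∀ (x : Position (suc n)) {k} j → (∀ i → k ≤ x i) → x j ≡ k → m x ≡ k
m-unique x j k≤ xj≡k = ≤-antisym (≤-trans (m-lowerBound x j) (≤-reflexive xj≡k)) (m-greatest x k≤)

m-mono : ∀ (x y : Position (suc n)) → (∀ i → y i ≤ x i) → m y ≤ m x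
m-mono x y y≤x = m-greatest x (λ i → ≤-trans (m-lowerBound y i) (y≤x i))

∈-M⁻ : ∀ (x : Position (suc n)) {i} → i ∈ M x → x i ≡ m x
∈-M⁻ x {i} = ≡ᵇ⇒≡ (x i) (m x) ∘ ∈-select⁻ (λ j → x j ≡ᵇ m x)

∈-M⁺ : ∀ (x : Position (suc n)) {i} → x i ≡ m x → i ∈ M x
∈-M⁺ x {i} = ∈-select⁺ (λ j → x j ≡ᵇ m x) ∘ ≡⇒≡ᵇ (x i) (m x)

∉-M⇒m< : ∀ (x : Position (suc n)) {i} → i ∉ M x → m x < x i
∉-M⇒m< x {i} i∉ = ≤∧≢⇒< (m-lowerBound x i) (i∉ ∘ ∈-M⁺ x ∘ sym)

∁M≢⊤ : ∀ (x : Position (suc n)) → ∁ (M x) ≢ ⊤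
∁M≢⊤ x ∁M≡⊤ = let (j , xj≡) = m-attained x in
  x∈∁p⇒x∉p (subst (j ∈_) (sym ∁M≡⊤) ∈⊤) (∈-M⁺ x xj≡)

IsTransversal-mono : ∀ {ℋ : Hypergraph n} {T T'} → T ⊆ T' → IsTransversal ℋ T → IsTransversal ℋ T'
IsTransversal-mono T⊆T' T-tr F F∈ = let (i , i∈T , i∈F) = T-tr F F∈ in i , T⊆T' i∈T , i∈F

⊈∁⇒Meets : ∀ {A F : Subset n} → ¬ F ⊆ ∁ A → Meets A F
⊈∁⇒Meets {A = A} {F} F⊈∁A with any? (λ i → (i ∈? A) ×-dec (i ∈? F))
... | yes meet = meet
... | no ¬meet = contradiction (λ {i} i∈F → x∉p⇒x∈∁p (λ i∈A → ¬meet (i , i∈A , i∈F))) F⊈∁A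

nonTransversal⇒∁-nonempty : ∀ {ℋ : Hypergraph n} {A} → NoEmptyEdge ℋ → ¬ IsTransversal ℋ A → Nonempty (∁ A)
nonTransversal⇒∁-nonempty {A = A} noEmpty A-nonTr with nonempty? (∁ A)
... | yes ne = ne
... | no ¬ne = contradiction everything-transversal A-nonTr
  where
  everything-transversal : IsTransversal _ A
  everything-transversal F F∈ = let (i , i∈F) = noEmpty F F∈ in
    i , x∉∁p⇒x∈p (λ i∈∁A → ¬ne (i , i∈∁A)) , i∈F

restrict-transversal-∪ : ∀ {ℋ : Hypergraph n} {A H} →
  IsTransversal (restrict ℋ (∁ A)) H → IsTransversal ℋ (H ∪ A)
restrict-transversal-∪ {A = A} H-tr F F∈ with F ⊆? ∁ A
... | yes F⊆∁A = let (i , i∈H , i∈F) = H-tr F (∈-filter⁺ (_⊆? ∁ A) F∈ F⊆∁A) in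
  i , x∈p∪q⁺ (inj₁ i∈H) , i∈F
... | no F⊈∁A = let (i , i∈A , i∈F) = ⊈∁⇒Meets F⊈∁A in
  i , x∈p∪q⁺ (inj₂ i∈A) , i∈F

M⊆decreased : ∀ (x x' : Position (suc n)) → m x' < m x → M x' ⊆ decreased x x'
M⊆decreased x x' m'<m {i} i∈M' = ∈-decreased⁺ x x' (begin-strict
  x' i  ≡⟨ ∈-M⁻ x' i∈M' ⟩
  m x'  <⟨ m'<m ⟩
  m x   ≤⟨ m-lowerBound x i ⟩
  x i   ∎)
  where open ≤-Reasoning

M∩decreased-empty : ∀ (x x' : Position (suc n)) → m x ≤ m x' → ∀ {i} → i ∈ M x → i ∉ decreased x x'
M∩decreased-empty x x' m≤m' {i} i∈M i∈D = <-irrefl refl (begin-strict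
  x' i  <⟨ ∈-decreased⁻ x x' i∈D ⟩
  x i   ≡⟨ ∈-M⁻ x i∈M ⟩
  m x   ≤⟨ m≤m' ⟩
  m x'  ≤⟨ m-lowerBound x' i ⟩
  x' i  ∎)
  where open ≤-Reasoning

InN⇒level : ∀ (ℋ : Hypergraph (suc n)) → (∀ H → H ∈ₗ ℋ → ¬ IsTransversal ℋ H) →
  ∀ k x → InN ℋ k x → m x ≡ k × ¬ IsTransversal ℋ (M x)
InN⇒level ℋ edge-nonTr k x (x' , (x'≤x , D∈ℋ) , m'≡k , M'-tr) = trans m≡m' m'≡k , M-nonTr
  where
  m≡m' : m x ≡ m x'
  m≡m' = ≤-antisym
    (≮⇒≥ (λ m'<m → edge-nonTr _ D∈ℋ (IsTransversal-mono (M⊆decreased x x' m'<m) M'-tr)))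
    (m-mono x x' x'≤x)

  M-nonTr : ¬ IsTransversal ℋ (M x)
  M-nonTr M-tr = let (i , i∈M , i∈D) = M-tr _ D∈ℋ in
    M∩decreased-empty x x' (≤-reflexive m≡m') i∈M i∈D

lowerOn : Subset n → ℕ → Position n → Position n
lowerOn H k x i with i ∈? H
... | yes _ = k
... | no  _ = x i

lowerOn-≤ : ∀ (H : Subset n) {k} (x : Position n) → (∀ {i} → i ∈ H → k ≤ x i) →
  ∀ i → lowerOn H k x i ≤ x i
lowerOn-≤ H x k≤ i with i ∈? H
... | yes i∈H = k≤ i∈H
... | no  _   = ≤-refl

decreased-lowerOn : ∀ (H : Subset n) {k} (x : Position n) → (∀ {i} → i ∈ H → k < x i) →
  decreased x (lowerOn H k x) ≡ H
decreased-lowerOn H {k} x k< = ⊆-antisym D⊆H H⊆D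
  where
  D⊆H : decreased x (lowerOn H k x) ⊆ H
  D⊆H {i} i∈D with i ∈? H | ∈-decreased⁻ x (lowerOn H k x) i∈D
  ... | yes i∈H | _    = i∈H
  ... | no  _   | xi<xi = contradiction xi<xi (<-irrefl refl)

  H⊆D : H ⊆ decreased x (lowerOn H k x)
  H⊆D {i} i∈H = ∈-decreased⁺ x (lowerOn H k x) (lowered i∈H)
    where
    lowered : i ∈ H → lowerOn H k x i < x i
    lowered i∈H with i ∈? H
    ... | yes _   = k< i∈H
    ... | no  i∉H = contradiction i∈H i∉H

m-lowerOn : ∀ (H : Subset (suc n)) (x : Position (suc n)) → m (lowerOn H (m x) x) ≡ m x
m-lowerOn {n} H x = m-unique (lowerOn H (m x) x) j above atMinimum
  where
  j : Fin (suc n)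
  j = proj₁ (m-attained x)

  above : ∀ i → m x ≤ lowerOn H (m x) x i
  above i with i ∈? H
  ... | yes _ = ≤-refl
  ... | no  _ = m-lowerBound x i

  atMinimum : lowerOn H (m x) x j ≡ m x
  atMinimum with j ∈? H
  ... | yes _ = refl
  ... | no  _ = proj₂ (m-attained x)

M-lowerOn : ∀ (H : Subset (suc n)) (x : Position (suc n)) → H ∪ M x ⊆ M (lowerOn H (m x) x)
M-lowerOn H x {i} i∈H∪M = ∈-M⁺ (lowerOn H (m x) x) (trans (atMinimum (x∈p∪q⁻ H (M x) i∈H∪M)) (sym (m-lowerOn H x)))
  where
  atMinimum : i ∈ H ⊎ i ∈ M x → lowerOn H (m x) x i ≡ m x
  atMinimum i∈ with i ∈? H | i∈
  ... | yes _   | _          = refl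
  ... | no  i∉H | inj₁ i∈H   = contradiction i∈H i∉H
  ... | no  _   | inj₂ i∈M   = ∈-M⁻ x i∈M

restrictedTransversal⇒InN : ∀ (ℋ : Hypergraph (suc n)) x {H} →
  H ∈ₗ restrict ℋ (∁ (M x)) → IsTransversal (restrict ℋ (∁ (M x))) H → InN ℋ (m x) x
restrictedTransversal⇒InN ℋ x {H} H∈ℋ-S H-tr =
  lowerOn H (m x) x ,
  (lowerOn-≤ H x (λ _ → m-lowerBound x _) , subst (_∈ₗ ℋ) (sym (decreased-lowerOn H x H-above)) H∈ℋ) ,
  m-lowerOn H x ,
  IsTransversal-mono (M-lowerOn H x) (restrict-transversal-∪ H-tr)
  where
  H∈ℋ : H ∈ₗ ℋ
  H∈ℋ = proj₁ (∈-filter⁻ (_⊆? ∁ (M x)) {xs = ℋ} H∈ℋ-S)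

  H-above : ∀ {i} → i ∈ H → m x < x i
  H-above i∈H = ∉-M⇒m< x (x∈∁p⇒x∉p (proj₂ (∈-filter⁻ (_⊆? ∁ (M x)) {xs = ℋ} H∈ℋ-S) i∈H))

level⇒InN : ∀ (ℋ : Hypergraph (suc n)) → NoEmptyEdge ℋ → MTF ℋ →
  ∀ x → ¬ IsTransversal ℋ (M x) → InN ℋ (m x) x
level⇒InN ℋ noEmpty (_ , restrict-selfTransversal) x M-nonTr =
  let (_ , H∈ℋ-S , H-tr) = restrict-selfTransversal (∁ (M x))
                             (nonTransversal⇒∁-nonempty noEmpty M-nonTr) (∁M≢⊤ x)
  in restrictedTransversal⇒InN ℋ x H∈ℋ-S H-tr

mainTheorem6 : ∀ {n} (ℋ : Hypergraph (suc n)) → NoEmptyEdge ℋ → MTF ℋ →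
    ∀ (k : ℕ) (x : Position (suc n)) →
      InN ℋ k x ⇔ (m x ≡ k × ¬ IsTransversal ℋ (M x))
mainTheorem6 ℋ noEmpty mtf k x = mk⇔
  (InN⇒level ℋ (proj₁ mtf) k x)
  (λ (m≡k , M-nonTr) → subst (λ l → InN ℋ l x) m≡k (level⇒InN ℋ noEmpty mtf x M-nonTr))
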